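{- Let $G_n=H_0H_1\cdots H_{n-1}$ be a spiro hexagonal chain with $n$ hexagons, and let $c_k$ be the common cut-vertex of $H_{k-1}$ and $H_k$, $1\le k\le n-1$. Then $$W(G_n)=5\sum_{k=1}^{n-1}\sum_{i=1}^{k} f(c_i)+\frac{45}{2}n^2+\frac92 n=5\sum_{k=1}^{n-1}(n-k)f(c_k)+\frac{45}{2}n^2+\frac92 n,$$ where $f(c_1)=9$ and, for $k\ge 2$, $$f(c_k)=\begin{cases}5(k-1)+9,& c_k \text{ is } o_{k-1},\\ 10(k-1)+9,& c_k\text{ is } m_{k-1},\\ 15(k-1)+9,& c_k\text{ is } p_{k-1}.\end{cases}$$
   Context: The Wiener index is $W(G)=\sum_{\{u,v\}\subseteq V(G)} d(u,v)$, with $d$ the shortest-path distance. A spiro hexagonal chain with $n$ hexagons is a graph $G_n=H_0H_1\cdots H_{n-1}$ that is the union of hexagons (6-cycles) $H_0,\dots,H_{n-1}$ such that for $1\le k\le n-1$, $H_{k-1}$ and $H_k$ share exactly one vertex $c_k$, the $c_k$ are distinct, and $H_i,H_j$ are disjoint when $|i-j|\ge 2$. For $k\ge 1$, a vertex $v$ of $H_k$ is called an ortho-, meta- or para-vertex of $H_k$, written $o_k$, $m_k$, $p_k$, if its distance from $c_k$ is $1$, $2$ or $3$ respectively; thus for $k\ge2$, $c_k$ is $o_{k-1}$, $m_{k-1}$ or $p_{k-1}$ according as $d(c_{k-1},c_k)=1,2,3$. -}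

module Defs where

open import Data.Bool using (Bool; true; false; if_then_else_; _∧_)
open import Data.Nat using (ℕ; zero; suc; _+_; _*_; _∸_; _<_; _≤_; _<ᵇ_)
open import Data.Fin using (Fin; toℕ) renaming (zero to f0; suc to fs)
open import Data.Fin.Properties using (_≟_)
open import Data.List using (List; map)
open import Data.Nat.ListAction using (sum)
open import Data.Bool.ListAction using (any)
open import Data.List.Base using (allFin)
open import Data.Product using (Σ; ∃; _×_; _,_)
open import Data.Sum using (_⊎_)
open import Relation.Nullary using (¬_)
open import Relation.Nullary.Decidable using (⌊_⌋)
open import Relation.Binary.PropositionalEquality using (_≡_; _≢_)

record Graph : Set where
  field
    N     : ℕ
    adj   : Fin N → Fin N → Bool
    sym   : ∀ u v → adj u v ≡ adj v u
    irref : ∀ u → adj u u ≡ false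

module _ (G : Graph) where
  open Graph G

  walkOf : ℕ → Fin N → Fin N → Bool
  walkOf zero    u v = ⌊ u ≟ v ⌋
  walkOf (suc k) u v = any (λ w → adj u w ∧ walkOf k w v) (allFin N)

  -- least k in [i, i+fuel) with a walk of length k from u to v
  -- (returns i + fuel if none; irrelevant for connected graphs)
  search : ℕ → ℕ → Fin N → Fin N → ℕ
  search zero       i u v = i
  search (suc fuel) i u v = if walkOf i u v then i else search fuel (suc i) u v

  -- shortest-path distance d(u,v): the least length of a u–v walk
  -- (a shortest walk is a path, so its length is at most N)
  dist : Fin N → Fin N → ℕ
  dist u v = search (suc N) 0 u v

  wiener : ℕ
  wiener = sum (map (λ u → sum (map (λ v → if toℕ u <ᵇ toℕ v then dist u v else 0)
                                     (allFin N)))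
                    (allFin N))

-- Hexagons: a 6-cycle given by an injective map Fin 6 → V, with
-- consecutive vertices i, next i adjacent.

next : Fin 6 → Fin 6
next f0 = fs f0
next (fs f0) = fs (fs f0)
next (fs (fs f0)) = fs (fs (fs f0))
next (fs (fs (fs f0))) = fs (fs (fs (fs f0)))
next (fs (fs (fs (fs f0)))) = fs (fs (fs (fs (fs f0))))
next (fs (fs (fs (fs (fs f0))))) = f0

sumTo : ℕ → (ℕ → ℕ) → ℕ
sumTo zero    g = 0
sumTo (suc m) g = sumTo m g + g (suc m)

record IsSpiroHexChain (G : Graph) (n : ℕ)
         (H : ℕ → Fin 6 → Fin (Graph.N G)) (c : ℕ → Fin (Graph.N G)) : Set where
  open Graph G
  field
    hexInj   : ∀ k → k < n → ∀ i j → H k i ≡ H k j → i ≡ j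
    hexEdge  : ∀ k → k < n → ∀ i → adj (H k i) (H k (next i)) ≡ true
    coverV   : ∀ v → ∃ λ k → k < n × ∃ λ i → H k i ≡ v
    coverE   : ∀ u v → adj u v ≡ true →
               ∃ λ k → k < n × ∃ λ i →
                 (u ≡ H k i × v ≡ H k (next i)) ⊎ (v ≡ H k i × u ≡ H k (next i))
    cutL     : ∀ k → 1 ≤ k → k < n → ∃ λ i → H (k ∸ 1) i ≡ c k
    cutR     : ∀ k → 1 ≤ k → k < n → ∃ λ i → H k i ≡ c k
    cutOnly  : ∀ k → 1 ≤ k → k < n → ∀ i j → H (k ∸ 1) i ≡ H k j → H k j ≡ c k
    cutDist  : ∀ j k → 1 ≤ j → j < k → k < n → c j ≢ c k
    disjoint : ∀ i j → 2 + i ≤ j → j < n → ∀ a b → H i a ≢ H j b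

-- f(c_k): f(c_1) = 9; for k ≥ 2 by whether c_k is o/m/p_{k-1},
-- i.e. d(c_{k-1}, c_k) = 1, 2, 3.
fCoef : ℕ → ℕ → ℕ
fCoef 1 k = 5 * (k ∸ 1) + 9
fCoef 2 k = 10 * (k ∸ 1) + 9
fCoef 3 k = 15 * (k ∸ 1) + 9
fCoef _ k = 0   -- cannot occur in a spiro hexagonal chain

f : (G : Graph) → (ℕ → Fin (Graph.N G)) → ℕ → ℕ
f G c zero          = 9   -- unused (k ranges over 1..n-1)
f G c (suc zero)    = 9
f G c (suc (suc j)) = fCoef (dist G (c (suc j)) (c (suc (suc j)))) (suc (suc j))

module Submission where

-- Label the vertices by pairs (k , i), position i of hexagon H_k; a vertex has one
-- label except a cut vertex c_k, which has one in H_{k-1} and one in H_k.  For two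
-- labels we write down the predicted distance labelDist: the hexagon distance d₆
-- inside one hexagon, otherwise the route through the cut vertices between them.
-- It is realised by a walk and changes by at most one along every edge, hence it is
-- the graph distance (dist-formula).  Summing over one canonical label per vertex
-- turns 2W(G_n) into the double sum pairSum n.  Adding hexagon H_m raises pairSum by
-- 10·toCut m + 18·|H_0 ⋯ H_{m-1}| + 36, where toCut m is the distance sum from the
-- older vertices to c_m, whose increments are the f(c_k); induction on m gives the
-- first formula, and exchanging the triangular double sum gives the second.

open import Defs
open import Data.Bool using (Bool; true; false; if_then_else_; _∧_; not; T)
open import Data.Bool.Properties using (T-≡; T-∧)
open import Data.Nat using (ℕ; zero; suc; _+_; _*_; _∸_; _<_; _≤_; _<ᵇ_; _<?_; z≤n; s≤s; ∣_-_∣; _⊓_)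
open import Data.Nat.Properties hiding (_≟_; suc-injective)
import Data.Nat.Properties as ℕ
open import Data.Fin using (Fin; toℕ) renaming (zero to f0; suc to fs)
open import Data.Fin.Properties using (_≟_; toℕ-injective; suc-injective; all?)
open import Data.List using (tabulate; map; allFin)
open import Data.List.Properties using (map-tabulate)
open import Data.List.Relation.Unary.Any using (satisfied)
open import Data.List.Relation.Unary.Any.Properties using (any⁺; any⁻)
open import Data.List.Membership.Propositional using (lose)
open import Data.List.Membership.Propositional.Properties using (∈-allFin)
open import Data.Nat.ListAction using (sum)
open import Data.Product using (∃; _×_; _,_; proj₁; proj₂)
open import Data.Sum using (_⊎_; inj₁; inj₂)
open import Data.Empty using (⊥-elim)
open import Function using (_∘_)
open import Function.Bundles using (Equivalence)
open import Relation.Nullary using (¬_; Dec; yes; no; _because_)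
open import Relation.Nullary.Decidable using (⌊_⌋; dec-true; dec-false; isYes≗does; from-yes; _→-dec_; _⊎-dec_)
open import Relation.Binary.Definitions using (tri<; tri≈; tri>)
open import Relation.Binary.PropositionalEquality
open import Algebra.Properties.Semiring.Sum +-*-semiring
  using (sum-cong-≗; sum-replicate-zero; ∑-comm; ∑-distrib-+; *-distribˡ-sum)
  renaming (sum to ∑)
open import Algebra.Properties.CommutativeSemigroup +-commutativeSemigroup using (interchange)
open import Data.Nat.Solver using (module +-*-Solver)
open +-*-Solver using (solve; _:+_; _:*_; _:=_; con)

open Equivalence using (to; from)

⌊⌋-yes : ∀ {A : Set} (a? : Dec A) → A → ⌊ a? ⌋ ≡ true
⌊⌋-yes a? a = trans (isYes≗does a?) (dec-true a? a)

⌊⌋-no : ∀ {A : Set} (a? : Dec A) → ¬ A → ⌊ a? ⌋ ≡ false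
⌊⌋-no a? ¬a = trans (isYes≗does a?) (dec-false a? ¬a)

sum-allFin : ∀ {n} (g : Fin n → ℕ) → sum (map g (allFin n)) ≡ ∑ g
sum-allFin g = trans (cong sum (map-tabulate (λ i → i) g)) (sum-tabulate g)
  where
    sum-tabulate : ∀ {n} (g : Fin n → ℕ) → sum (tabulate g) ≡ ∑ g
    sum-tabulate {zero}  g = refl
    sum-tabulate {suc n} g = cong (g f0 +_) (sum-tabulate (g ∘ fs))

∑-zero : ∀ {n} {g : Fin n → ℕ} → (∀ i → g i ≡ 0) → ∑ g ≡ 0
∑-zero {n} g≡0 = trans (sum-cong-≗ g≡0) (sum-replicate-zero n)

∑-single : ∀ {n} (g : Fin n → ℕ) (i₀ : Fin n) → (∀ i → i ≢ i₀ → g i ≡ 0) → ∑ g ≡ g i₀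
∑-single g f0      off = trans (cong (g f0 +_) (∑-zero (λ i → off (fs i) λ ()))) (+-identityʳ _)
∑-single g (fs i₀) off = cong₂ _+_ (off f0 λ ()) (∑-single (g ∘ fs) i₀ (λ i i≢ → off (fs i) (i≢ ∘ suc-injective)))

∑-indicator : ∀ {n} (x : Fin n) (g : Fin n → ℕ) → ∑ (λ v → if ⌊ x ≟ v ⌋ then g v else 0) ≡ g x
∑-indicator x g =
  trans (∑-single _ x (λ v v≢x → cong (if_then g v else 0) (⌊⌋-no (x ≟ v) (v≢x ∘ sym))))
        (cong (if_then g x else 0) (⌊⌋-yes (x ≟ x) refl))

∑-one : ∀ n → ∑ {n} (λ _ → 1) ≡ n
∑-one zero    = refl
∑-one (suc n) = cong suc (∑-one n)

∑-if : ∀ {n} (b : Bool) (g : Fin n → ℕ) → ∑ (λ i → if b then g i else 0) ≡ (if b then ∑ g else 0)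
∑-if true  g = refl
∑-if {n} false g = ∑-zero {n} (λ _ → refl)

-- sumBelow m F = F 0 + ⋯ + F (m-1); hexagon H_k of a chain contributes
-- the k-th term, so the recursion peels off the last hexagon.
sumBelow : ℕ → (ℕ → ℕ) → ℕ
sumBelow zero    F = 0
sumBelow (suc m) F = sumBelow m F + F m

sumBelow-cong : ∀ m {F F′ : ℕ → ℕ} → (∀ k → k < m → F k ≡ F′ k) → sumBelow m F ≡ sumBelow m F′
sumBelow-cong zero    eq = refl
sumBelow-cong (suc m) eq = cong₂ _+_ (sumBelow-cong m (λ k k<m → eq k (m<n⇒m<1+n k<m))) (eq m ≤-refl)

sumBelow-+ : ∀ m (F F′ : ℕ → ℕ) → sumBelow m (λ k → F k + F′ k) ≡ sumBelow m F + sumBelow m F′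
sumBelow-+ zero    F F′ = refl
sumBelow-+ (suc m) F F′ = trans (cong (_+ (F m + F′ m)) (sumBelow-+ m F F′)) (interchange (sumBelow m F) (sumBelow m F′) (F m) (F′ m))

sumBelow-* : ∀ m x (F : ℕ → ℕ) → sumBelow m (λ k → x * F k) ≡ x * sumBelow m F
sumBelow-* zero    x F = sym (*-zeroʳ x)
sumBelow-* (suc m) x F = trans (cong (_+ x * F m) (sumBelow-* m x F)) (sym (*-distribˡ-+ x _ _))

sumBelow-zero : ∀ m {F : ℕ → ℕ} → (∀ k → k < m → F k ≡ 0) → sumBelow m F ≡ 0
sumBelow-zero m F≡0 = trans (sumBelow-cong m {F′ = λ _ → 0} F≡0) (vanish m)
  where
    vanish : ∀ m → sumBelow m (λ _ → 0) ≡ 0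
    vanish zero    = refl
    vanish (suc m) = cong (_+ 0) (vanish m)

sumBelow-single : ∀ m (F : ℕ → ℕ) k₀ → k₀ < m → (∀ k → k < m → k ≢ k₀ → F k ≡ 0) → sumBelow m F ≡ F k₀
sumBelow-single (suc m) F k₀ k₀<1+m off with m≤n⇒m<n∨m≡n (≤-pred k₀<1+m)
... | inj₁ k₀<m = trans (cong₂ _+_ (sumBelow-single m F k₀ k₀<m (λ k k<m → off k (m<n⇒m<1+n k<m)))
                                   (off m ≤-refl (λ m≡k₀ → <⇒≢ k₀<m (sym m≡k₀))))
                        (+-identityʳ (F k₀))
... | inj₂ refl = cong (_+ F m) (sumBelow-zero m (λ k k<m → off k (m<n⇒m<1+n k<m) (<⇒≢ k<m)))

∑-sumBelow : ∀ {n} m (F : ℕ → Fin n → ℕ) → ∑ (λ v → sumBelow m (λ k → F k v)) ≡ sumBelow m (λ k → ∑ (F k))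
∑-sumBelow {n} zero    F = ∑-zero {n} (λ _ → refl)
∑-sumBelow     (suc m) F = trans (∑-distrib-+ (λ v → sumBelow m (λ k → F k v)) (F m))
                                 (cong (_+ ∑ (F m)) (∑-sumBelow m F))

sumTo-cong : ∀ m {g g′ : ℕ → ℕ} → (∀ k → 1 ≤ k → k ≤ m → g k ≡ g′ k) → sumTo m g ≡ sumTo m g′
sumTo-cong zero    eq = refl
sumTo-cong (suc m) eq = cong₂ _+_ (sumTo-cong m (λ k 1≤k k≤m → eq k 1≤k (m≤n⇒m≤1+n k≤m))) (eq (suc m) (s≤s z≤n) ≤-refl)

sumTo-+ : ∀ m (g g′ : ℕ → ℕ) → sumTo m (λ k → g k + g′ k) ≡ sumTo m g + sumTo m g′
sumTo-+ zero    g g′ = refl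
sumTo-+ (suc m) g g′ = trans (cong (_+ (g (suc m) + g′ (suc m))) (sumTo-+ m g g′))
                             (interchange (sumTo m g) (sumTo m g′) (g (suc m)) (g′ (suc m)))

sumTo-triangle : ∀ m (g : ℕ → ℕ) → sumTo m (λ k → sumTo k g) ≡ sumTo m (λ k → (suc m ∸ k) * g k)
sumTo-triangle zero    g = refl
sumTo-triangle (suc m) g = begin
  sumTo m (λ k → sumTo k g) + sumTo (suc m) g
    ≡⟨ cong (_+ sumTo (suc m) g) (sumTo-triangle m g) ⟩
  R + (sumTo m g + g (suc m))
    ≡⟨ solve 3 (λ t s x → t :+ (s :+ x) := (s :+ t) :+ con 1 :* x) refl R (sumTo m g) (g (suc m)) ⟩
  (sumTo m g + R) + 1 * g (suc m)
    ≡⟨ cong₂ _+_ (sym (sumTo-+ m g (λ k → (suc m ∸ k) * g k))) (cong (_* g (suc m)) (sym (m+n∸n≡m 1 (suc m)))) ⟩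
  sumTo m (λ k → g k + (suc m ∸ k) * g k) + (suc (suc m) ∸ suc m) * g (suc m)
    ≡⟨ cong (_+ ((suc (suc m) ∸ suc m) * g (suc m)))
            (sumTo-cong m (λ k _ k≤m → cong (_* g k) (sym (+-∸-assoc 1 (m≤n⇒m≤1+n k≤m))))) ⟩
  sumTo (suc m) (λ k → (suc (suc m) ∸ k) * g k)
    ∎
  where
    open ≡-Reasoning
    R : ℕ
    R = sumTo m (λ k → (suc m ∸ k) * g k)

-- Walks and distances in an arbitrary finite graph.
module Distance (G : Graph) where
  open Graph G using (N; adj)

  data Walk : ℕ → Fin N → Fin N → Set where
    []  : ∀ {u} → Walk 0 u u
    _∷_ : ∀ {k u w v} → adj u w ≡ true → Walk k w v → Walk (suc k) u v

  castWalk : ∀ {k k′ u u′ v v′} → k ≡ k′ → u ≡ u′ → v ≡ v′ → Walk k u v → Walk k′ u′ v′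
  castWalk refl refl refl p = p

  _++_ : ∀ {k l u v w} → Walk k u v → Walk l v w → Walk (k + l) u w
  []      ++ q = q
  (e ∷ p) ++ q = e ∷ (p ++ q)

  reverse : ∀ {k u v} → Walk k u v → Walk k v u
  reverse []                  = []
  reverse (_∷_ {u = u} {w} e p) =
    castWalk (+-comm _ 1) refl refl (reverse p ++ (trans (Graph.sym G w u) e ∷ []))

  walkOf-sound : ∀ k u v → walkOf G k u v ≡ true → Walk k u v
  walkOf-sound zero u v u≟v with u ≟ v
  ... | yes refl = []
  walkOf-sound zero u v () | no _
  walkOf-sound (suc k) u v found with satisfied (any⁻ _ (allFin N) (from T-≡ found))
  ... | w , uw∧wv = to T-≡ (proj₁ (to T-∧ uw∧wv)) ∷ walkOf-sound k w v (to T-≡ (proj₂ (to T-∧ uw∧wv)))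

  walkOf-complete : ∀ {k u v} → Walk k u v → walkOf G k u v ≡ true
  walkOf-complete {u = u} [] = ⌊⌋-yes (u ≟ u) refl
  walkOf-complete {suc k} {u} {v} (_∷_ {w = w} e p) =
    to T-≡ (any⁺ step (lose {P = T ∘ step} (∈-allFin w) (from T-∧ (from T-≡ e , from T-≡ (walkOf-complete p)))))
    where
      step : Fin N → Bool
      step x = adj u x ∧ walkOf G k x v

  search-least : ∀ fuel i d u v → i ≤ d → d < i + fuel → Walk d u v →
                 (∀ m → i ≤ m → m < d → walkOf G m u v ≡ false) → search G fuel i u v ≡ d
  search-least zero       i d u v i≤d d<i+0 p shorter =
    ⊥-elim (<-irrefl refl (<-≤-trans d<i+0 (subst (_≤ d) (sym (+-identityʳ i)) i≤d)))
  search-least (suc fuel) i d u v i≤d d<i+fuel p shorter with m≤n⇒m<n∨m≡n i≤d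
  ... | inj₂ refl rewrite walkOf-complete p = refl
  ... | inj₁ i<d rewrite shorter i ≤-refl i<d =
    search-least fuel (suc i) d u v i<d (subst (d <_) (+-suc i fuel) d<i+fuel) p
                 (λ m i<m m<d → shorter m (<⇒≤ i<m) m<d)

  dist-exact : ∀ d u v → d ≤ N → Walk d u v → (∀ m → Walk m u v → d ≤ m) → dist G u v ≡ d
  dist-exact d u v d≤N p shortest = search-least (suc N) 0 d u v z≤n (s≤s d≤N) p none-shorter
    where
      none-shorter : ∀ m → 0 ≤ m → m < d → walkOf G m u v ≡ false
      none-shorter m _ m<d with walkOf G m u v in found
      ... | false = refl
      ... | true  = ⊥-elim (<⇒≱ m<d (shortest m (walkOf-sound m u v found)))

  Lipschitz : (Fin N → ℕ) → Set
  Lipschitz ψ = ∀ x w → adj x w ≡ true → ψ w ≤ suc (ψ x)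

  potential-bound : ∀ (ψ : Fin N → ℕ) → Lipschitz ψ → ∀ {m x z} → Walk m x z → ψ z ≤ ψ x + m
  potential-bound ψ lip {x = x} [] = ≤-reflexive (sym (+-identityʳ (ψ x)))
  potential-bound ψ lip {suc m} {x} (_∷_ {w = w} e p) = begin
    _              ≤⟨ potential-bound ψ lip p ⟩
    ψ w + m        ≤⟨ +-monoˡ-≤ m (lip x w e) ⟩
    suc (ψ x) + m  ≡⟨ +-suc (ψ x) m ⟨
    ψ x + suc m    ∎
    where open ≤-Reasoning

  dist-by-potential : ∀ (ψ : Fin N → ℕ) → Lipschitz ψ → ∀ u v → ψ u ≡ 0 → ψ v ≤ N →
                      Walk (ψ v) u v → dist G u v ≡ ψ v
  dist-by-potential ψ lip u v ψu≡0 ψv≤N p =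
    dist-exact (ψ v) u v ψv≤N p (λ m q → subst (λ t → ψ v ≤ t + m) ψu≡0 (potential-bound ψ lip q))

  dist-refl : ∀ u → dist G u u ≡ 0
  dist-refl u rewrite ⌊⌋-yes (u ≟ u) refl = refl

  dist-sym : ∀ u v → dist G u v ≡ dist G v u
  dist-sym u v = search-sym (suc N) 0
    where
      walkOf-sym : ∀ k → walkOf G k u v ≡ walkOf G k v u
      walkOf-sym k with walkOf G k u v in uv | walkOf G k v u in vu
      ... | true  | true  = refl
      ... | false | false = refl
      ... | true  | false = trans (sym (walkOf-complete (reverse (walkOf-sound k u v uv)))) vu
      ... | false | true  = trans (sym uv) (walkOf-complete (reverse (walkOf-sound k v u vu)))

      search-sym : ∀ fuel i → search G fuel i u v ≡ search G fuel i v u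
      search-sym zero       i = refl
      search-sym (suc fuel) i rewrite walkOf-sym i | search-sym fuel (suc i) = refl

  twice-wiener : 2 * wiener G ≡ ∑ (λ u → ∑ (λ v → dist G u v))
  twice-wiener = begin
    2 * wiener G                                   ≡⟨ cong (2 *_) unfold ⟩
    2 * S                                          ≡⟨ cong (S +_) (+-identityʳ S) ⟩
    S + S                                          ≡⟨ cong (S +_) (∑-comm (λ u v → half u v)) ⟩
    S + ∑ (λ u → ∑ (λ v → half v u))               ≡⟨ ∑-distrib-+ (λ u → ∑ (half u)) (λ u → ∑ (λ v → half v u)) ⟨
    ∑ (λ u → ∑ (half u) + ∑ (λ v → half v u))      ≡⟨ sum-cong-≗ (λ u → ∑-distrib-+ (half u) (λ v → half v u)) ⟨
    ∑ (λ u → ∑ (λ v → half u v + half v u))        ≡⟨ sum-cong-≗ (λ u → sum-cong-≗ (halves u)) ⟩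
    ∑ (λ u → ∑ (λ v → dist G u v))                 ∎
    where
      open ≡-Reasoning
      half : Fin N → Fin N → ℕ
      half u v = if toℕ u <ᵇ toℕ v then dist G u v else 0

      S : ℕ
      S = ∑ (λ u → ∑ (half u))

      unfold : wiener G ≡ S
      unfold = trans (sum-allFin (λ u → sum (map (half u) (allFin N)))) (sum-cong-≗ (λ u → sum-allFin (half u)))

      <ᵇ-true : ∀ {a b} → a < b → (a <ᵇ b) ≡ true
      <ᵇ-true a<b = to T-≡ (<⇒<ᵇ a<b)

      <ᵇ-false : ∀ {a b} → ¬ a < b → (a <ᵇ b) ≡ false
      <ᵇ-false {a} {b} = dec-false (_ because <ᵇ-reflects-< a b)

      halves : ∀ u v → half u v + half v u ≡ dist G u v
      halves u v with <-cmp (toℕ u) (toℕ v)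
      ... | tri< u<v _ v≮u rewrite <ᵇ-true u<v | <ᵇ-false v≮u = +-identityʳ _
      ... | tri> u≮v _ v<u rewrite <ᵇ-false u≮v | <ᵇ-true v<u = dist-sym v u
      ... | tri≈ u≮v u≡v _ rewrite toℕ-injective u≡v | <ᵇ-false u≮v = sym (dist-refl v)

d₆ : Fin 6 → Fin 6 → ℕ
d₆ p q = ∣ toℕ p - toℕ q ∣ ⊓ (6 ∸ ∣ toℕ p - toℕ q ∣)

advance : ℕ → Fin 6 → Fin 6
advance zero    p = p
advance (suc s) p = advance s (next p)

∑-except : Fin 6 → (Fin 6 → ℕ) → ℕ
∑-except x g = ∑ (λ i → if not ⌊ i ≟ x ⌋ then g i else 0)

d₆-sym : ∀ p q → d₆ p q ≡ d₆ q p
d₆-sym = from-yes (all? λ p → all? λ q → d₆ p q ℕ.≟ d₆ q p)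

d₆-self : ∀ p → d₆ p p ≡ 0
d₆-self = from-yes (all? λ p → d₆ p p ℕ.≟ 0)

d₆-zero : ∀ p q → d₆ p q ≡ 0 → p ≡ q
d₆-zero = from-yes (all? λ p → all? λ q → (d₆ p q ℕ.≟ 0) →-dec (p ≟ q))

d₆≤3 : ∀ p q → d₆ p q ≤ 3
d₆≤3 = from-yes (all? λ p → all? λ q → d₆ p q ℕ.≤? 3)

d₆-next : ∀ x p → d₆ x (next p) ≤ suc (d₆ x p)
d₆-next = from-yes (all? λ x → all? λ p → d₆ x (next p) ℕ.≤? suc (d₆ x p))

d₆-prev : ∀ x p → d₆ x p ≤ suc (d₆ x (next p))
d₆-prev = from-yes (all? λ x → all? λ p → d₆ x p ℕ.≤? suc (d₆ x (next p)))

d₆-arc : ∀ p q → advance (d₆ p q) p ≡ q ⊎ advance (d₆ p q) q ≡ p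
d₆-arc = from-yes (all? λ p → all? λ q → (advance (d₆ p q) p ≟ q) ⊎-dec (advance (d₆ p q) q ≟ p))

∑-d₆ : ∀ q → ∑ (λ i → d₆ i q) ≡ 9
∑-d₆ = from-yes (all? λ q → ∑ (λ i → d₆ i q) ℕ.≟ 9)

∑-except-one : ∀ x → ∑-except x (λ _ → 1) ≡ 5
∑-except-one = from-yes (all? λ x → ∑-except x (λ _ → 1) ℕ.≟ 5)

∑-except-from : ∀ x → ∑-except x (d₆ x) ≡ 9
∑-except-from = from-yes (all? λ x → ∑-except x (d₆ x) ℕ.≟ 9)

∑-except-to : ∀ x q → ∑-except x (λ i → d₆ i q) + d₆ x q ≡ 9
∑-except-to = from-yes (all? λ x → all? λ q → (∑-except x (λ i → d₆ i q) + d₆ x q) ℕ.≟ 9)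

∑-except-pairs : ∀ x → ∑-except x (λ i → ∑-except x (d₆ i)) ≡ 36
∑-except-pairs = from-yes (all? λ x → ∑-except x (λ i → ∑-except x (d₆ i)) ℕ.≟ 36)

-- The distance structure of a spiro hexagonal chain H_0 ⋯ H_{n-1}.
module SpiroChain (G : Graph) (n : ℕ) (H : ℕ → Fin 6 → Fin (Graph.N G))
                  (c : ℕ → Fin (Graph.N G)) (chain : IsSpiroHexChain G n H c) where
  open Graph G using (N; adj)
  open IsSpiroHexChain chain
  open Distance G

  -- A label (k , i) with k < n names the vertex H k i.  The cut vertex c_k
  -- (1 ≤ k < n) sits at position entry k of H_k and at position exit (k-1) of H_{k-1}.
  entry : ℕ → Fin 6
  entry zero = f0
  entry (suc j) with suc j <? n
  ... | yes 1+j<n = proj₁ (cutR (suc j) (s≤s z≤n) 1+j<n)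
  ... | no  _     = f0

  exit : ℕ → Fin 6
  exit j with suc j <? n
  ... | yes 1+j<n = proj₁ (cutL (suc j) (s≤s z≤n) 1+j<n)
  ... | no  _     = f0

  entry-cut : ∀ j → suc j < n → H (suc j) (entry (suc j)) ≡ c (suc j)
  entry-cut j 1+j<n with suc j <? n
  ... | yes 1+j<n′ = proj₂ (cutR (suc j) (s≤s z≤n) 1+j<n′)
  ... | no  1+j≮n  = ⊥-elim (1+j≮n 1+j<n)

  exit-cut : ∀ j → suc j < n → H j (exit j) ≡ c (suc j)
  exit-cut j 1+j<n with suc j <? n
  ... | yes 1+j<n′ = proj₂ (cutL (suc j) (s≤s z≤n) 1+j<n′)
  ... | no  1+j≮n  = ⊥-elim (1+j≮n 1+j<n)

  -- Two labels of one vertex are equal, or are the two labels of a cut vertex.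
  data SameVertex : ℕ → Fin 6 → ℕ → Fin 6 → Set where
    same    : ∀ {j p} → SameVertex j p j p
    forward : ∀ {j} → SameVertex j (exit j) (suc j) (entry (suc j))
    back    : ∀ {j} → SameVertex (suc j) (entry (suc j)) j (exit j)

  flip : ∀ {j p j′ p′} → SameVertex j p j′ p′ → SameVertex j′ p′ j p
  flip same    = same
  flip forward = back
  flip back    = forward

  coincide< : ∀ j p j′ p′ → j < j′ → j′ < n → H j p ≡ H j′ p′ → SameVertex j p j′ p′
  coincide< j p j′ p′ j<j′ j′<n eq with m≤n⇒m<n∨m≡n j<j′
  ... | inj₁ 1+j<j′ = ⊥-elim (disjoint j j′ 1+j<j′ j′<n p p′ eq)
  ... | inj₂ refl = labels-of-cut
      (hexInj j (<-trans (n<1+n j) j′<n) p (exit j) (trans eq (trans at-cut (sym (exit-cut j j′<n)))))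
      (hexInj (suc j) j′<n p′ (entry (suc j)) (trans at-cut (sym (entry-cut j j′<n))))
    where
      at-cut : H (suc j) p′ ≡ c (suc j)
      at-cut = cutOnly (suc j) (s≤s z≤n) j′<n p p′ eq

      labels-of-cut : p ≡ exit j → p′ ≡ entry (suc j) → SameVertex j p (suc j) p′
      labels-of-cut refl refl = forward

  coincide : ∀ j p j′ p′ → j < n → j′ < n → H j p ≡ H j′ p′ → SameVertex j p j′ p′
  coincide j p j′ p′ j<n j′<n eq with <-cmp j j′
  ... | tri< j<j′ _ _ = coincide< j p j′ p′ j<j′ j′<n eq
  ... | tri≈ _ refl _ rewrite hexInj j j<n p p′ eq = same
  ... | tri> _ _ j′<j = flip (coincide< j′ p′ j p j′<j j<n (sym eq))

  -- Every vertex has exactly one canonical label: we drop the label (k , entry k)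
  -- of each cut vertex c_k, keeping its label in H_{k-1}.
  canonical : ℕ → Fin 6 → Bool
  canonical zero    i = true
  canonical (suc k) i = not ⌊ i ≟ entry (suc k) ⌋

  entry-not-canonical : ∀ k → canonical (suc k) (entry (suc k)) ≢ true
  entry-not-canonical k canon with entry (suc k) ≟ entry (suc k) | canon
  ... | yes _      | ()
  ... | no  ≢entry | _ = ≢entry refl

  canonical-label : ∀ k i → k < n → ∃ λ k₀ → ∃ λ i₀ → k₀ < n × canonical k₀ i₀ ≡ true × H k₀ i₀ ≡ H k i
  canonical-label zero    i 0<n = 0 , i , 0<n , refl , refl
  canonical-label (suc k) i 1+k<n with i ≟ entry (suc k)
  ... | no  i≢entry = suc k , i , 1+k<n , cong not (⌊⌋-no (i ≟ entry (suc k)) i≢entry) , refl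
  ... | yes refl with canonical-label k (exit k) (<-trans (n<1+n k) 1+k<n)
  ...   | k₀ , i₀ , k₀<n , canon , at =
          k₀ , i₀ , k₀<n , canon , trans at (trans (exit-cut k 1+k<n) (sym (entry-cut k 1+k<n)))

  canonical-unique : ∀ k i k′ i′ → k < n → k′ < n → canonical k i ≡ true → canonical k′ i′ ≡ true →
                     H k i ≡ H k′ i′ → k ≡ k′ × i ≡ i′
  canonical-unique k i k′ i′ k<n k′<n canon canon′ eq with coincide k i k′ i′ k<n k′<n eq
  ... | same    = refl , refl
  ... | forward = ⊥-elim (entry-not-canonical k canon′)
  ... | back    = ⊥-elim (entry-not-canonical k′ canon)

  row : ℕ → (Fin 6 → ℕ) → ℕ
  row k g = ∑ (λ i → if canonical k i then g i else 0)

  labelSum : ℕ → (ℕ → Fin 6 → ℕ) → ℕ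
  labelSum m g = sumBelow m (λ k → row k (g k))

  labelSum-single : ∀ m (g : ℕ → Fin 6 → ℕ) k₀ i₀ → k₀ < m → canonical k₀ i₀ ≡ true →
                    (∀ k i → k < m → canonical k i ≡ true → (k ≡ k₀ × i ≡ i₀) ⊎ g k i ≡ 0) →
                    labelSum m g ≡ g k₀ i₀
  labelSum-single m g k₀ i₀ k₀<m canon₀ others = begin
    labelSum m g                                   ≡⟨ sumBelow-single m _ k₀ k₀<m (λ k k<m k≢k₀ → ∑-zero (λ i → off k i k<m (k≢k₀ ∘ proj₁))) ⟩
    row k₀ (g k₀)                                  ≡⟨ ∑-single _ i₀ (λ i i≢i₀ → off k₀ i k₀<m (i≢i₀ ∘ proj₂)) ⟩
    (if canonical k₀ i₀ then g k₀ i₀ else 0)       ≡⟨ cong (if_then g k₀ i₀ else 0) canon₀ ⟩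
    g k₀ i₀                                        ∎
    where
      open ≡-Reasoning
      off : ∀ k i → k < m → ¬ (k ≡ k₀ × i ≡ i₀) → (if canonical k i then g k i else 0) ≡ 0
      off k i k<m not₀ with canonical k i in canon
      ... | false = refl
      ... | true with others k i k<m canon
      ...   | inj₁ is₀ = ⊥-elim (not₀ is₀)
      ...   | inj₂ g≡0 = g≡0

  transfer : ∀ (g : Fin N → ℕ) → ∑ g ≡ labelSum n (λ k i → g (H k i))
  transfer g = begin
    ∑ g
      ≡⟨ sum-cong-≗ (λ v → sym (one-label v)) ⟩
    ∑ (λ v → labelSum n (λ k i → at k i v))
      ≡⟨ ∑-sumBelow n (λ k v → row k (λ i → at k i v)) ⟩
    sumBelow n (λ k → ∑ (λ v → row k (λ i → at k i v)))
      ≡⟨ sumBelow-cong n (λ k _ → ∑-comm (λ v i → if canonical k i then at k i v else 0)) ⟩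
    sumBelow n (λ k → ∑ (λ i → ∑ (λ v → if canonical k i then at k i v else 0)))
      ≡⟨ sumBelow-cong n (λ k _ → sum-cong-≗ (λ i → trans (∑-if (canonical k i) (at k i))
                                   (cong (if canonical k i then_else 0) (∑-indicator (H k i) g)))) ⟩
    labelSum n (λ k i → g (H k i))
      ∎
    where
      open ≡-Reasoning
      at : ℕ → Fin 6 → Fin N → ℕ
      at k i v = if ⌊ H k i ≟ v ⌋ then g v else 0

      one-label : ∀ v → labelSum n (λ k i → at k i v) ≡ g v
      one-label v with coverV v
      ... | k , k<n , i , Hki≡v with canonical-label k i k<n
      ...   | k₀ , i₀ , k₀<n , canon₀ , same-vertex =
              trans (labelSum-single n (λ k i → at k i v) k₀ i₀ k₀<n canon₀ others)
                    (cong (if_then g v else 0) (⌊⌋-yes (H k₀ i₀ ≟ v) at₀))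
        where
          at₀ : H k₀ i₀ ≡ v
          at₀ = trans same-vertex Hki≡v

          others : ∀ k′ i′ → k′ < n → canonical k′ i′ ≡ true → (k′ ≡ k₀ × i′ ≡ i₀) ⊎ at k′ i′ v ≡ 0
          others k′ i′ k′<n canon′ with H k′ i′ ≟ v
          ... | yes at′ = inj₁ (canonical-unique k′ i′ k₀ i₀ k′<n k₀<n canon′ canon₀ (trans at′ (sym at₀)))
          ... | no  _   = inj₂ refl

  size : ℕ → ℕ
  size k = row k (λ _ → 1)

  size-suc : ∀ k → size (suc k) ≡ 5
  size-suc k = ∑-except-one (entry (suc k))

  vertices : ℕ → ℕ
  vertices m = sumBelow m size

  vertices-suc : ∀ m → vertices (suc m) ≡ 6 + 5 * m
  vertices-suc zero    = refl
  vertices-suc (suc m) = begin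
    vertices (suc m) + size (suc m)       ≡⟨ cong₂ _+_ (vertices-suc m) (size-suc m) ⟩
    6 + 5 * m + 5                         ≡⟨ solve 1 (λ m → con 6 :+ con 5 :* m :+ con 5 := con 6 :+ con 5 :* (con 1 :+ m)) refl m ⟩
    6 + 5 * suc m                         ∎
    where open ≡-Reasoning

  vertex-count : ∀ m → n ≡ suc m → N ≡ 6 + 5 * m
  vertex-count m n≡1+m = begin
    N                              ≡⟨ ∑-one N ⟨
    ∑ {N} (λ _ → 1)                ≡⟨ transfer (λ _ → 1) ⟩
    vertices n                     ≡⟨ cong vertices n≡1+m ⟩
    vertices (suc m)               ≡⟨ vertices-suc m ⟩
    6 + 5 * m                      ∎
    where open ≡-Reasoning

  -- Hence distances, which are at most 3n + 3, never exceed N.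
  vertex-bound : ∀ {k} → k < n → 3 * n + 3 ≤ N
  vertex-bound {k} k<n = bound n refl k<n
    where
      bound : ∀ n′ → n ≡ n′ → k < n′ → 3 * n′ + 3 ≤ N
      bound (suc m) n≡1+m _ = begin
        3 * suc m + 3   ≡⟨ solve 1 (λ m → con 3 :* (con 1 :+ m) :+ con 3 := con 6 :+ con 3 :* m) refl m ⟩
        6 + 3 * m       ≤⟨ +-monoʳ-≤ 6 (*-monoˡ-≤ m (s≤s (s≤s (s≤s (z≤n {2}))))) ⟩
        6 + 5 * m       ≡⟨ vertex-count m n≡1+m ⟨
        N               ∎
        where open ≤-Reasoning

  -- δ j = d(c_j, c_{j+1}): the distance inside H_j between its two cut vertices.
  δ : ℕ → ℕ
  δ j = d₆ (entry j) (exit j)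

  -- spine k j = δ (k+1) + ⋯ + δ (j-1) = d(c_{k+1}, c_j) for k < j, and 0 otherwise.
  spine : ℕ → ℕ → ℕ
  spine k zero    = 0
  spine k (suc j) with k <? j
  ... | yes _ = spine k j + δ j
  ... | no  _ = 0

  spine-base : ∀ k → spine k (suc k) ≡ 0
  spine-base k with k <? k
  ... | yes k<k = ⊥-elim (<-irrefl refl k<k)
  ... | no  _   = refl

  spine-step : ∀ k j → k < j → spine k (suc j) ≡ spine k j + δ j
  spine-step k j k<j with k <? j
  ... | yes _   = refl
  ... | no  k≮j = ⊥-elim (k≮j k<j)

  spine-front : ∀ k j → suc k < j → spine k j ≡ δ (suc k) + spine (suc k) j
  spine-front k (suc j) 1+k<1+j with m≤n⇒m<n∨m≡n (≤-pred 1+k<1+j)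
  ... | inj₂ refl rewrite spine-step k (suc k) (n<1+n k) | spine-base k | spine-base (suc k) = +-comm 0 (δ (suc k))
  ... | inj₁ 1+k<j rewrite spine-step k j (<-trans (n<1+n k) 1+k<j) | spine-step (suc k) j 1+k<j
                         | spine-front k j 1+k<j = +-assoc (δ (suc k)) (spine (suc k) j) (δ j)

  spine-bound : ∀ k j → spine k j ≤ 3 * j
  spine-bound k zero    = z≤n
  spine-bound k (suc j) with k <? j
  ... | yes _ = ≤-trans (+-mono-≤ (spine-bound k j) (d₆≤3 (entry j) (exit j)))
                        (≤-reflexive (trans (+-comm (3 * j) 3) (sym (*-suc 3 j))))
  ... | no  _ = z≤n

  -- Predicted distance between the vertices labelled (k , i) and (j , p): inside one
  -- hexagon it is d₆; for k < j the path leaves H_k at c_{k+1}, follows the spine to c_j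
  -- and enters H_j there.
  across : ℕ → Fin 6 → ℕ → Fin 6 → ℕ
  across k i j p = d₆ i (exit k) + spine k j + d₆ (entry j) p

  labelDist : ℕ → Fin 6 → ℕ → Fin 6 → ℕ
  labelDist k i j p with <-cmp k j
  ... | tri< _ _ _ = across k i j p
  ... | tri≈ _ _ _ = d₆ i p
  ... | tri> _ _ _ = across j p k i

  labelDist-< : ∀ {k i j p} → k < j → labelDist k i j p ≡ across k i j p
  labelDist-< {k} {j = j} k<j with <-cmp k j
  ... | tri< _ _ _     = refl
  ... | tri≈ k≮j _ _ = ⊥-elim (k≮j k<j)
  ... | tri> k≮j _ _ = ⊥-elim (k≮j k<j)

  labelDist-hex : ∀ k i p → labelDist k i k p ≡ d₆ i p
  labelDist-hex k i p with <-cmp k k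
  ... | tri< k<k _ _ = ⊥-elim (<-irrefl refl k<k)
  ... | tri≈ _ _ _   = refl
  ... | tri> _ _ k<k = ⊥-elim (<-irrefl refl k<k)

  labelDist-sym : ∀ k i j p → labelDist k i j p ≡ labelDist j p k i
  labelDist-sym k i j p with <-cmp k j | <-cmp j k
  ... | tri< _ _ _     | tri> _ _ _     = refl
  ... | tri≈ _ _ _     | tri≈ _ _ _     = d₆-sym i p
  ... | tri> _ _ _     | tri< _ _ _     = refl
  ... | tri< k<j _ _   | tri< j<k _ _   = ⊥-elim (<-asym k<j j<k)
  ... | tri< k<j _ _   | tri≈ _ j≡k _   = ⊥-elim (<-irrefl (sym j≡k) k<j)
  ... | tri≈ _ k≡j _   | tri< j<k _ _   = ⊥-elim (<-irrefl (sym k≡j) j<k)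
  ... | tri≈ _ k≡j _   | tri> _ _ k<j   = ⊥-elim (<-irrefl k≡j k<j)
  ... | tri> _ _ j<k   | tri≈ _ j≡k _   = ⊥-elim (<-irrefl j≡k j<k)
  ... | tri> _ _ j<k   | tri> _ _ k<j   = ⊥-elim (<-asym k<j j<k)

  labelDist-> : ∀ {k i j p} → j < k → labelDist k i j p ≡ across j p k i
  labelDist-> {k} {i} {j} {p} j<k = trans (labelDist-sym k i j p) (labelDist-< j<k)

  labelDist-cut : ∀ k i j → labelDist k i j (exit j) ≡ labelDist k i (suc j) (entry (suc j))
  labelDist-cut k i j with <-cmp k j
  ... | tri< k<j _ _
        rewrite labelDist-< {k} {i} {suc j} {entry (suc j)} (m<n⇒m<1+n k<j)
              | spine-step k j k<j | d₆-self (entry (suc j))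
        = solve 3 (λ a s d → a :+ s :+ d := a :+ (s :+ d) :+ con 0) refl (d₆ i (exit k)) (spine k j) (δ j)
  ... | tri≈ _ refl _
        rewrite labelDist-< {k} {i} {suc k} {entry (suc k)} (n<1+n k)
              | spine-base k | d₆-self (entry (suc k))
        = sym (trans (+-identityʳ _) (+-identityʳ _))
  ... | tri> _ _ j<k with m≤n⇒m<n∨m≡n j<k
  ...   | inj₂ refl rewrite labelDist-hex (suc j) i (entry (suc j)) | d₆-self (exit j) | spine-base j
        = d₆-sym (entry (suc j)) i
  ...   | inj₁ 1+j<k rewrite labelDist-> {k} {i} {suc j} {entry (suc j)} 1+j<k
                           | d₆-self (exit j) | spine-front j k 1+j<k
        = refl

  labelDist-same : ∀ k i {j p j′ p′} → SameVertex j p j′ p′ → labelDist k i j p ≡ labelDist k i j′ p′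
  labelDist-same k i same            = refl
  labelDist-same k i (forward {j})   = labelDist-cut k i j
  labelDist-same k i (back {j})      = sym (labelDist-cut k i j)

  labelDist-next : ∀ k i j p → labelDist k i j (next p) ≤ suc (labelDist k i j p)
  labelDist-next k i j p with <-cmp k j
  ... | tri< _ _ _ = ≤-trans (+-monoʳ-≤ (d₆ i (exit k) + spine k j) (d₆-next (entry j) p)) (≤-reflexive (+-suc _ _))
  ... | tri≈ _ _ _ = d₆-next i p
  ... | tri> _ _ _ rewrite d₆-sym (next p) (exit j) | d₆-sym p (exit j) =
        +-monoˡ-≤ (d₆ (entry k) i) (+-monoˡ-≤ (spine j k) (d₆-next (exit j) p))

  labelDist-prev : ∀ k i j p → labelDist k i j p ≤ suc (labelDist k i j (next p))
  labelDist-prev k i j p with <-cmp k j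
  ... | tri< _ _ _ = ≤-trans (+-monoʳ-≤ (d₆ i (exit k) + spine k j) (d₆-prev (entry j) p)) (≤-reflexive (+-suc _ _))
  ... | tri≈ _ _ _ = d₆-prev i p
  ... | tri> _ _ _ rewrite d₆-sym (next p) (exit j) | d₆-sym p (exit j) =
        +-monoˡ-≤ (d₆ (entry k) i) (+-monoˡ-≤ (spine j k) (d₆-prev (exit j) p))

  arcWalk : ∀ j → j < n → ∀ s p → Walk s (H j p) (H j (advance s p))
  arcWalk j j<n zero    p = []
  arcWalk j j<n (suc s) p = hexEdge j j<n p ∷ arcWalk j j<n s (next p)

  hexWalk : ∀ j → j < n → ∀ p q → Walk (d₆ p q) (H j p) (H j q)
  hexWalk j j<n p q with d₆-arc p q
  ... | inj₁ p↝q = castWalk refl refl (cong (H j) p↝q) (arcWalk j j<n (d₆ p q) p)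
  ... | inj₂ q↝p = reverse (castWalk refl refl (cong (H j) q↝p) (arcWalk j j<n (d₆ p q) q))

  spineWalk : ∀ k j → k < j → j < n → Walk (spine k j) (c (suc k)) (c j)
  spineWalk k (suc j) k<1+j 1+j<n with m≤n⇒m<n∨m≡n (≤-pred k<1+j)
  ... | inj₂ refl = castWalk (sym (spine-base k)) refl refl []
  spineWalk k (suc (suc t)) _ 2+t<n | inj₁ k<1+t =
    castWalk (sym (spine-step k (suc t) k<1+t)) refl refl (spineWalk k (suc t) k<1+t 1+t<n ++ through)
    where
      1+t<n : suc t < n
      1+t<n = <-trans (n<1+n (suc t)) 2+t<n

      through : Walk (δ (suc t)) (c (suc t)) (c (suc (suc t)))
      through = castWalk refl (entry-cut t 1+t<n) (exit-cut (suc t) 2+t<n)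
                         (hexWalk (suc t) 1+t<n (entry (suc t)) (exit (suc t)))

  acrossWalk : ∀ k i j p → k < j → j < n → Walk (across k i j p) (H k i) (H j p)
  acrossWalk k i (suc t) p k<1+t 1+t<n =
    (castWalk refl refl (exit-cut k 1+k<n) (hexWalk k k<n i (exit k)) ++ spineWalk k (suc t) k<1+t 1+t<n)
      ++ castWalk refl (entry-cut t 1+t<n) refl (hexWalk (suc t) 1+t<n (entry (suc t)) p)
    where
      1+k<n : suc k < n
      1+k<n = ≤-<-trans k<1+t 1+t<n

      k<n : k < n
      k<n = <-trans (n<1+n k) 1+k<n

  labelWalk : ∀ k i j p → k < n → j < n → Walk (labelDist k i j p) (H k i) (H j p)
  labelWalk k i j p k<n j<n with <-cmp k j
  ... | tri< k<j _ _ = acrossWalk k i j p k<j j<n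
  ... | tri≈ _ refl _ = hexWalk k k<n i p
  ... | tri> _ _ j<k = reverse (acrossWalk j p k i j<k k<n)

  across-bound : ∀ k i j p → j < n → across k i j p ≤ 3 * n + 3
  across-bound k i j p j<n =
    ≤-trans (+-mono-≤ (+-mono-≤ (d₆≤3 i (exit k)) (spine-bound k j)) (d₆≤3 (entry j) p))
            (+-monoˡ-≤ 3 (subst (_≤ 3 * n) (*-suc 3 j) (*-monoʳ-≤ 3 j<n)))

  labelDist-bound : ∀ k i j p → k < n → j < n → labelDist k i j p ≤ 3 * n + 3
  labelDist-bound k i j p k<n j<n with <-cmp k j
  ... | tri< _ _ _ = across-bound k i j p j<n
  ... | tri≈ _ _ _ = ≤-trans (d₆≤3 i p) (m≤n+m 3 (3 * n))
  ... | tri> _ _ _ = across-bound j p k i k<n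

  -- The potential of a vertex: its predicted distance from H k i, read off any of its labels.
  potential : ℕ → Fin 6 → Fin N → ℕ
  potential k i v with coverV v
  ... | j , _ , p , _ = labelDist k i j p

  potential-at : ∀ k i j p → j < n → potential k i (H j p) ≡ labelDist k i j p
  potential-at k i j p j<n with coverV (H j p)
  ... | j′ , j′<n , p′ , same-vertex = labelDist-same k i (coincide j′ p′ j p j′<n j<n same-vertex)

  -- Every edge lies on a hexagon, so the potential is Lipschitz.
  potential-lipschitz : ∀ k i → Lipschitz (potential k i)
  potential-lipschitz k i x w xw with coverE x w xw
  ... | j , j<n , q , inj₁ (refl , refl)
        rewrite potential-at k i j q j<n | potential-at k i j (next q) j<n = labelDist-next k i j q
  ... | j , j<n , q , inj₂ (refl , refl)
        rewrite potential-at k i j q j<n | potential-at k i j (next q) j<n = labelDist-prev k i j q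

  dist-formula : ∀ k i j p → k < n → j < n → dist G (H k i) (H j p) ≡ labelDist k i j p
  dist-formula k i j p k<n j<n = trans
    (dist-by-potential (potential k i) (potential-lipschitz k i) (H k i) (H j p) starts-at-0 bounded walk)
    at-end
    where
      at-end : potential k i (H j p) ≡ labelDist k i j p
      at-end = potential-at k i j p j<n

      starts-at-0 : potential k i (H k i) ≡ 0
      starts-at-0 = trans (potential-at k i k i k<n) (trans (labelDist-hex k i i) (d₆-self i))

      bounded : potential k i (H j p) ≤ N
      bounded = subst (_≤ N) (sym at-end) (≤-trans (labelDist-bound k i j p k<n j<n) (vertex-bound k<n))

      walk : Walk (potential k i (H j p)) (H k i) (H j p)
      walk = castWalk (sym at-end) refl refl (labelWalk k i j p k<n j<n)

  row-cong : ∀ k {g g′ : Fin 6 → ℕ} → (∀ i → g i ≡ g′ i) → row k g ≡ row k g′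
  row-cong k eq = sum-cong-≗ (λ i → cong (if canonical k i then_else 0) (eq i))

  row-+ : ∀ k (g g′ : Fin 6 → ℕ) → row k (λ i → g i + g′ i) ≡ row k g + row k g′
  row-+ k g g′ = trans (sum-cong-≗ (λ i → if-+ (canonical k i) {g i} {g′ i}))
                       (∑-distrib-+ (λ i → if canonical k i then g i else 0) (λ i → if canonical k i then g′ i else 0))
    where
      if-+ : ∀ b {x y} → (if b then x + y else 0) ≡ (if b then x else 0) + (if b then y else 0)
      if-+ true  = refl
      if-+ false = refl

  row-* : ∀ k x (g : Fin 6 → ℕ) → row k (λ i → x * g i) ≡ x * row k g
  row-* k x g = trans (sum-cong-≗ (λ i → if-* (canonical k i) {g i})) (sym (*-distribˡ-sum x (λ i → if canonical k i then g i else 0)))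
    where
      if-* : ∀ b {y} → (if b then x * y else 0) ≡ x * (if b then y else 0)
      if-* true  = refl
      if-* false = sym (*-zeroʳ x)

  row-const : ∀ k x → row k (λ _ → x) ≡ x * size k
  row-const k x = trans (row-cong k (λ _ → sym (*-identityʳ x))) (row-* k x (λ _ → 1))

  labelSum-cong : ∀ m {g g′ : ℕ → Fin 6 → ℕ} → (∀ k i → k < m → g k i ≡ g′ k i) → labelSum m g ≡ labelSum m g′
  labelSum-cong m eq = sumBelow-cong m (λ k k<m → row-cong k (λ i → eq k i k<m))

  labelSum-+ : ∀ m (g g′ : ℕ → Fin 6 → ℕ) → labelSum m (λ k i → g k i + g′ k i) ≡ labelSum m g + labelSum m g′
  labelSum-+ m g g′ = trans (sumBelow-cong m (λ k _ → row-+ k (g k) (g′ k))) (sumBelow-+ m _ _)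

  labelSum-* : ∀ m x (g : ℕ → Fin 6 → ℕ) → labelSum m (λ k i → x * g k i) ≡ x * labelSum m g
  labelSum-* m x g = trans (sumBelow-cong m (λ k _ → row-* k x (g k))) (sumBelow-* m x _)

  labelSum-const : ∀ m x → labelSum m (λ _ _ → x) ≡ x * vertices m
  labelSum-const m x = trans (sumBelow-cong m (λ k _ → row-const k x)) (sumBelow-* m x size)

  pairSum : ℕ → ℕ
  pairSum m = labelSum m (λ k i → labelSum m (labelDist k i))

  twice-wiener-pairSum : 2 * wiener G ≡ pairSum n
  twice-wiener-pairSum = begin
    2 * wiener G                                                   ≡⟨ twice-wiener ⟩
    ∑ (λ u → ∑ (λ v → dist G u v))                                 ≡⟨ sum-cong-≗ (λ u → transfer (dist G u)) ⟩
    ∑ (λ u → labelSum n (λ j p → dist G u (H j p)))                ≡⟨ transfer _ ⟩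
    labelSum n (λ k i → labelSum n (λ j p → dist G (H k i) (H j p)))
      ≡⟨ labelSum-cong n (λ k i k<n → labelSum-cong n (λ j p j<n → dist-formula k i j p k<n j<n)) ⟩
    pairSum n                                                      ∎
    where open ≡-Reasoning

  toNew fromNew withinNew : ℕ → ℕ
  toNew     m = labelSum m (λ k i → row m (labelDist k i m))
  fromNew   m = row m (λ i → labelSum m (labelDist m i))
  withinNew m = row m (λ i → row m (labelDist m i m))

  pairSum-suc : ∀ m → pairSum (suc m) ≡ pairSum m + toNew m + fromNew m + withinNew m
  pairSum-suc m = begin
    pairSum (suc m)
      ≡⟨ cong₂ _+_ (sumBelow-cong m (λ k _ → row-+ k (λ i → labelSum m (labelDist k i)) (λ i → row m (labelDist k i m))))
                   (row-+ m (λ i → labelSum m (labelDist m i)) (λ i → row m (labelDist m i m))) ⟩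
    sumBelow m (λ k → row k (λ i → labelSum m (labelDist k i)) + row k (λ i → row m (labelDist k i m)))
      + (fromNew m + withinNew m)
      ≡⟨ cong (_+ (fromNew m + withinNew m)) (sumBelow-+ m _ _) ⟩
    (pairSum m + toNew m) + (fromNew m + withinNew m)
      ≡⟨ solve 4 (λ a b c d → (a :+ b) :+ (c :+ d) := a :+ b :+ c :+ d) refl (pairSum m) (toNew m) (fromNew m) (withinNew m) ⟩
    pairSum m + toNew m + fromNew m + withinNew m
      ∎
    where open ≡-Reasoning

  -- toCut m = Σ d(H k i , c_m) over the vertices H k i of H_0 ⋯ H_{m-1}: a shortest
  -- path leaves H_k at c_{k+1} and follows the spine to c_m.
  toCut : ℕ → ℕ
  toCut m = labelSum m (λ k i → d₆ i (exit k) + spine k m)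

  toCut-one : toCut 1 ≡ 9
  toCut-one = trans (row-cong 0 (λ i → trans (cong (d₆ i (exit 0) +_) (spine-base 0)) (+-identityʳ _)))
                    (∑-d₆ (exit 0))

  -- Moving the target from c_{t+1} to c_{t+2} lengthens the paths from the old vertices
  -- by δ(t+1), and adds the distances from H_{t+1} to c_{t+2}.
  toCut-suc : ∀ t → toCut (suc (suc t)) ≡ toCut (suc t) + (5 * suc t * δ (suc t) + 9)
  toCut-suc t = begin
    toCut (suc m)
      ≡⟨ cong₂ _+_ (labelSum-cong m (λ k i k<m → trans (cong (d₆ i (exit k) +_) (spine-step k m k<m))
                                                        (sym (+-assoc (d₆ i (exit k)) (spine k m) (δ m)))))
                   (row-cong m (λ i → trans (cong (d₆ i (exit m) +_) (spine-base m)) (+-identityʳ _))) ⟩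
    labelSum m (λ k i → (d₆ i (exit k) + spine k m) + δ m) + R
      ≡⟨ cong (_+ R) (trans (labelSum-+ m (λ k i → d₆ i (exit k) + spine k m) (λ _ _ → δ m)) (cong (toCut m +_) (labelSum-const m (δ m)))) ⟩
    toCut m + δ m * vertices m + R
      ≡⟨ cong (λ v → toCut m + δ m * v + R) (vertices-suc t) ⟩
    toCut m + δ m * (6 + 5 * t) + R
      ≡⟨ solve 4 (λ e d r t → e :+ d :* (con 6 :+ con 5 :* t) :+ r := e :+ (con 5 :* (con 1 :+ t) :* d :+ (r :+ d)))
               refl (toCut m) (δ m) R t ⟩
    toCut m + (5 * suc t * δ m + (R + δ m))
      ≡⟨ cong (λ z → toCut m + (5 * suc t * δ m + z)) (∑-except-to (entry m) (exit m)) ⟩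
    toCut m + (5 * suc t * δ m + 9)
      ∎
    where
      open ≡-Reasoning
      m = suc t
      R = row m (λ i → d₆ i (exit m))

  row-new : ∀ t x y → row (suc t) (λ p → x + y * d₆ (entry (suc t)) p) ≡ 5 * x + 9 * y
  row-new t x y = trans (row-+ (suc t) (λ _ → x) (λ p → y * d₆ (entry (suc t)) p))
    (cong₂ _+_ (trans (row-const (suc t) x) (trans (cong (x *_) (size-suc t)) (*-comm x 5)))
               (trans (row-* (suc t) y (d₆ (entry (suc t)))) (trans (cong (y *_) (∑-except-from (entry (suc t)))) (*-comm y 9))))

  toNew-suc : ∀ t → toNew (suc t) ≡ 5 * toCut (suc t) + 9 * vertices (suc t)
  toNew-suc t = begin
    toNew (suc t)
      ≡⟨ labelSum-cong (suc t) (λ k i k<m → trans (row-cong (suc t) (λ p → trans (labelDist-< {k} {i} {suc t} {p} k<m)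
                                  (cong (d₆ i (exit k) + spine k (suc t) +_) (sym (*-identityˡ (d₆ (entry (suc t)) p))))))
                                (row-new t (d₆ i (exit k) + spine k (suc t)) 1)) ⟩
    labelSum (suc t) (λ k i → 5 * (d₆ i (exit k) + spine k (suc t)) + 9 * 1)
      ≡⟨ trans (labelSum-+ (suc t) (λ k i → 5 * (d₆ i (exit k) + spine k (suc t))) (λ _ _ → 9))
               (cong₂ _+_ (labelSum-* (suc t) 5 (λ k i → d₆ i (exit k) + spine k (suc t))) (trans (labelSum-const (suc t) 9) (*-comm 9 (vertices (suc t))))) ⟩
    5 * toCut (suc t) + vertices (suc t) * 9
      ≡⟨ cong (5 * toCut (suc t) +_) (*-comm (vertices (suc t)) 9) ⟩
    5 * toCut (suc t) + 9 * vertices (suc t)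
      ∎
    where open ≡-Reasoning

  fromNew-suc : ∀ t → fromNew (suc t) ≡ 5 * toCut (suc t) + 9 * vertices (suc t)
  fromNew-suc t = trans (row-cong (suc t) from-i) (row-new t (toCut (suc t)) (vertices (suc t)))
    where
      from-i : ∀ i → labelSum (suc t) (labelDist (suc t) i)
                     ≡ toCut (suc t) + vertices (suc t) * d₆ (entry (suc t)) i
      from-i i = trans (labelSum-cong (suc t) (λ j p j<m → labelDist-> {suc t} {i} {j} {p} j<m))
        (trans (labelSum-+ (suc t) (λ j p → d₆ p (exit j) + spine j (suc t)) (λ _ _ → d₆ (entry (suc t)) i))
               (cong (toCut (suc t) +_) (trans (labelSum-const (suc t) (d₆ (entry (suc t)) i)) (*-comm (d₆ (entry (suc t)) i) (vertices (suc t))))))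

  withinNew-suc : ∀ t → withinNew (suc t) ≡ 36
  withinNew-suc t = trans (row-cong (suc t) (λ i → row-cong (suc t) (labelDist-hex (suc t) i)))
                          (∑-except-pairs (entry (suc t)))

  pairSum-closed : ∀ m → pairSum (suc m) ≡ 10 * sumTo m toCut + 45 * (suc m * suc m) + 9 * suc m
  pairSum-closed zero    = refl
  pairSum-closed (suc t) = begin
    pairSum (suc (suc t))
      ≡⟨ pairSum-suc (suc t) ⟩
    pairSum (suc t) + toNew (suc t) + fromNew (suc t) + withinNew (suc t)
      ≡⟨ cong₂ _+_ (cong₂ _+_ (cong₂ _+_ (pairSum-closed t) (toNew-suc t)) (fromNew-suc t)) (withinNew-suc t) ⟩
    10 * S + 45 * (suc t * suc t) + 9 * suc t + (5 * E + 9 * vertices (suc t)) + (5 * E + 9 * vertices (suc t)) + 36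
      ≡⟨ cong (λ v → 10 * S + 45 * (suc t * suc t) + 9 * suc t + (5 * E + 9 * v) + (5 * E + 9 * v) + 36) (vertices-suc t) ⟩
    10 * S + 45 * (suc t * suc t) + 9 * suc t + (5 * E + 9 * (6 + 5 * t)) + (5 * E + 9 * (6 + 5 * t)) + 36
      ≡⟨ solve 3 (λ s e t → con 10 :* s :+ con 45 :* ((con 1 :+ t) :* (con 1 :+ t)) :+ con 9 :* (con 1 :+ t)
                             :+ (con 5 :* e :+ con 9 :* (con 6 :+ con 5 :* t)) :+ (con 5 :* e :+ con 9 :* (con 6 :+ con 5 :* t)) :+ con 36
                           := con 10 :* (s :+ e) :+ con 45 :* ((con 2 :+ t) :* (con 2 :+ t)) :+ con 9 :* (con 2 :+ t))
               refl S E t ⟩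
    10 * sumTo (suc t) toCut + 45 * (suc (suc t) * suc (suc t)) + 9 * suc (suc t)
      ∎
    where
      open ≡-Reasoning
      S = sumTo t toCut
      E = toCut (suc t)

  fCoef-value : ∀ d k → 1 ≤ d → d ≤ 3 → fCoef d (suc k) ≡ 5 * k * d + 9
  fCoef-value 1 k _ _ = cong (_+ 9) (sym (*-identityʳ (5 * k)))
  fCoef-value 2 k _ _ = cong (_+ 9) (solve 1 (λ k → con 10 :* k := con 5 :* k :* con 2) refl k)
  fCoef-value 3 k _ _ = cong (_+ 9) (solve 1 (λ k → con 15 :* k := con 5 :* k :* con 3) refl k)
  fCoef-value (suc (suc (suc (suc d)))) k _ (s≤s (s≤s (s≤s ())))

  cut-distance : ∀ j → suc (suc j) < n → dist G (c (suc j)) (c (suc (suc j))) ≡ δ (suc j)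
  cut-distance j 2+j<n = begin
    dist G (c (suc j)) (c (suc (suc j)))
      ≡⟨ cong₂ (dist G) (sym (entry-cut j 1+j<n)) (sym (exit-cut (suc j) 2+j<n)) ⟩
    dist G (H (suc j) (entry (suc j))) (H (suc j) (exit (suc j)))
      ≡⟨ dist-formula (suc j) (entry (suc j)) (suc j) (exit (suc j)) 1+j<n 1+j<n ⟩
    labelDist (suc j) (entry (suc j)) (suc j) (exit (suc j))
      ≡⟨ labelDist-hex (suc j) (entry (suc j)) (exit (suc j)) ⟩
    δ (suc j)
      ∎
    where
      open ≡-Reasoning
      1+j<n : suc j < n
      1+j<n = <-trans (n<1+n (suc j)) 2+j<n

  -- Distinct cut vertices are at positive distance.
  δ-positive : ∀ j → suc (suc j) < n → 1 ≤ δ (suc j)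
  δ-positive j 2+j<n with δ (suc j) in δ≡
  ... | suc _ = s≤s z≤n
  ... | zero  = ⊥-elim (cutDist (suc j) (suc (suc j)) (s≤s z≤n) (n<1+n (suc j)) 2+j<n same-cut)
    where
      1+j<n : suc j < n
      1+j<n = <-trans (n<1+n (suc j)) 2+j<n

      same-cut : c (suc j) ≡ c (suc (suc j))
      same-cut = trans (sym (entry-cut j 1+j<n))
                       (trans (cong (H (suc j)) (d₆-zero _ _ δ≡)) (exit-cut (suc j) 2+j<n))

  f-increment : ∀ j → suc (suc j) < n → f G c (suc (suc j)) ≡ 5 * suc j * δ (suc j) + 9
  f-increment j 2+j<n = trans (cong (λ d → fCoef d (suc (suc j))) (cut-distance j 2+j<n))
                              (fCoef-value (δ (suc j)) (suc j) (δ-positive j 2+j<n) (d₆≤3 (entry (suc j)) (exit (suc j))))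

  sumTo-f : ∀ k → 1 ≤ k → k < n → sumTo k (f G c) ≡ toCut k
  sumTo-f (suc zero)    _ _     = sym toCut-one
  sumTo-f (suc (suc j)) _ 2+j<n =
    trans (cong₂ _+_ (sumTo-f (suc j) (s≤s z≤n) (<-trans (n<1+n (suc j)) 2+j<n)) (f-increment j 2+j<n))
          (sym (toCut-suc j))

-- Theorem 2.2: both closed forms of W(G_n), doubled to stay in ℕ.
theorem2p2 : (G : Graph) (n : ℕ) (H : ℕ → Fin 6 → Fin (Graph.N G))
    (c : ℕ → Fin (Graph.N G)) → IsSpiroHexChain G n H c →
    (2 * wiener G ≡ 10 * sumTo (n ∸ 1) (λ k → sumTo k (f G c)) + 45 * (n * n) + 9 * n)
    × (2 * wiener G ≡ 10 * sumTo (n ∸ 1) (λ k → (n ∸ k) * f G c k) + 45 * (n * n) + 9 * n)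
theorem2p2 G zero    H c chain = empty , empty
  where
    empty : 2 * wiener G ≡ 0
    empty = SpiroChain.twice-wiener-pairSum G zero H c chain
theorem2p2 G (suc m) H c chain = nested , trans nested (cong closed (sumTo-triangle m (f G c)))
  where
    open SpiroChain G (suc m) H c chain using (pairSum; twice-wiener-pairSum; pairSum-closed; sumTo-f; toCut)

    closed : ℕ → ℕ
    closed s = 10 * s + 45 * (suc m * suc m) + 9 * suc m

    nested : 2 * wiener G ≡ closed (sumTo m (λ k → sumTo k (f G c)))
    nested = begin
      2 * wiener G                              ≡⟨ twice-wiener-pairSum ⟩
      pairSum (suc m)                           ≡⟨ pairSum-closed m ⟩
      closed (sumTo m toCut)                    ≡⟨ cong closed (sumTo-cong m (λ k 1≤k k≤m → sym (sumTo-f k 1≤k (s≤s k≤m)))) ⟩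
      closed (sumTo m (λ k → sumTo k (f G c)))  ∎
      where open ≡-Reasoning
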